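{- Let $(G,K,\mathcal{T},tw)$ be an instance of Eulerian Steiner Subgraph with $\mathcal{T}$ the nearly-nice tree decomposition described in the context, let $r$ be its root, and let $v^\star$ be the terminal present in every bag. Then $G$ has an Eulerian Steiner subgraph for $K$ if and only if the partition $\{\{v^\star\}\}$ is valid for the combination $(r,\{v^\star\},\emptyset)$.
   Context: A graph is Eulerian if it is connected and all degrees are even. An instance of Eulerian Steiner Subgraph consists of a graph $G$, terminals $K\subseteq V(G)$ (assumed non-empty) and a tree decomposition of width $tw$; an Eulerian Steiner subgraph for $K$ is an Eulerian subgraph of $G$ containing all of $K$. A nice tree decomposition is a rooted tree decomposition with empty root and leaf bags in which each non-leaf node is an introduce vertex, introduce edge (each edge of $G$ introduced at exactly one node, with both endpoints in the bag), forget, or join node. The nearly-nice $\mathcal{T}$ is obtained from a nice one by adding a fixed terminal $v^\star\in K$ to every bag; so the root bag is $X_r=\{v^\star\}$. For node $t$: $V_t$ = union of bags in the subtree at $t$, $E_t$ = edges introduced in that subtree, $G_t=(V_t,E_t)$ (so $G_r=G$). For $X\subseteq X_t$, $O\subseteq X$, a partition $P=\{X^1,\dots,X^p\}$ of $X$ is valid for $(t,X,O)$ if some subgraph $G'_t$ of $G_t$ has $X_t\cap V(G'_t)=X$, exactly $p$ connected components $C_1,\dots,C_p$ with $X^i\subseteq V(C_i)$, contains every terminal of $K\cap V_t$, and has set of odd-degree vertices exactly $O$. -}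

module Defs where

open import Data.Nat using (ℕ; zero; suc; _+_; _%_)
open import Data.Bool using (Bool; true; false; _∨_; if_then_else_)
open import Data.Fin using (Fin; zero; suc)
open import Data.Fin.Properties using () renaming (_≟_ to _≟ᶠ_)
open import Data.Fin.Subset
  using (Subset; ⊥; ⊤; ⁅_⁆; _∈_; _∉_; _⊆_; _∩_; _∪_; _-_; ∣_∣)
open import Data.Vec using (tabulate)
open import Data.Product using (Σ; ∃; _×_; _,_; proj₁; proj₂)
open import Data.Sum using (_⊎_)
open import Relation.Nullary using (¬_)
open import Relation.Nullary.Decidable using (⌊_⌋)
open import Relation.Binary.PropositionalEquality using (_≡_; _≢_)
open import Function.Bundles using (_⇔_)

SameEnds : ∀ {n} → Fin n × Fin n → Fin n × Fin n → Set
SameEnds (a , b) (c , d) = ((a ≡ c) × (b ≡ d)) ⊎ ((a ≡ d) × (b ≡ c))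

record Graph : Set where
  field
    n        : ℕ
    m        : ℕ
    ends     : Fin m → Fin n × Fin n
    loopless : ∀ e → proj₁ (ends e) ≢ proj₂ (ends e)
    simple   : ∀ e f → SameEnds (ends e) (ends f) → e ≡ f

open Graph public

module _ (G : Graph) where

  incident : Fin (n G) → Fin (m G) → Bool
  incident v e = ⌊ proj₁ (ends G e) ≟ᶠ v ⌋ ∨ ⌊ proj₂ (ends G e) ≟ᶠ v ⌋

  degree : Subset (m G) → Fin (n G) → ℕ
  degree F v = ∣ F ∩ tabulate (incident v) ∣

  Joins : Fin (m G) → Fin (n G) → Fin (n G) → Set
  Joins e u w = SameEnds (ends G e) (u , w)

  IsSubgraphOf : Subset (n G) → Subset (m G) →
                 Subset (n G) → Subset (m G) → Set
  IsSubgraphOf U F Vt Et =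
    (U ⊆ Vt) × (F ⊆ Et) ×
    (∀ {e} → e ∈ F → (proj₁ (ends G e) ∈ U) × (proj₂ (ends G e) ∈ U))

  data Reach (U : Subset (n G)) (F : Subset (m G)) :
             Fin (n G) → Fin (n G) → Set where
    here : ∀ {v} → v ∈ U → Reach U F v v
    step : ∀ {u w x} e → e ∈ F → Joins e u w → Reach U F w x → Reach U F u x

  Connected : Subset (n G) → Subset (m G) → Set
  Connected U F = ∀ {u v} → u ∈ U → v ∈ U → Reach U F u v

  Odd : ℕ → Set
  Odd k = k % 2 ≡ 1

  OddSetIs : Subset (n G) → Subset (m G) → Subset (n G) → Set
  OddSetIs U F O = ∀ v → (v ∈ O) ⇔ ((v ∈ U) × Odd (degree F v))

  Eulerian : Subset (n G) → Subset (m G) → Set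
  Eulerian U F = Connected U F × (∀ v → v ∈ U → ¬ Odd (degree F v))

  HasEulerianSteinerSubgraph : Subset (n G) → Set
  HasEulerianSteinerSubgraph K =
    Σ (Subset (n G)) λ U → Σ (Subset (m G)) λ F →
      IsSubgraphOf U F ⊤ ⊤ × Eulerian U F × (K ⊆ U)

  -- Nice tree decompositions, as rooted trees whose nodes carry their kind.
  -- Bags are determined by the node kinds (leaf bags empty).

  data NTree : Set where
    leaf   : NTree
    introV : Fin (n G) → NTree → NTree
    introE : Fin (m G) → NTree → NTree
    forget : Fin (n G) → NTree → NTree
    join   : NTree → NTree → NTree

  bag : NTree → Subset (n G)
  bag leaf         = ⊥
  bag (introV v t) = bag t ∪ ⁅ v ⁆
  bag (introE e t) = bag t
  bag (forget v t) = bag t - v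
  bag (join l r)   = bag l

  Vt : NTree → Subset (n G)
  Vt leaf         = bag leaf
  Vt (introV v t) = bag (introV v t) ∪ Vt t
  Vt (introE e t) = bag (introE e t) ∪ Vt t
  Vt (forget v t) = bag (forget v t) ∪ Vt t
  Vt (join l r)   = bag (join l r) ∪ (Vt l ∪ Vt r)

  Et : NTree → Subset (m G)
  Et leaf         = ⊥
  Et (introV v t) = Et t
  Et (introE e t) = ⁅ e ⁆ ∪ Et t
  Et (forget v t) = Et t
  Et (join l r)   = Et l ∪ Et r

  introCount : Fin (m G) → NTree → ℕ
  introCount f leaf         = 0
  introCount f (introV v t) = introCount f t
  introCount f (introE e t) =
    (if ⌊ e ≟ᶠ f ⌋ then 1 else 0) + introCount f t
  introCount f (forget v t) = introCount f t
  introCount f (join l r)   = introCount f l + introCount f r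

  -- Local well-formedness of every node: node-type conditions of a nice
  -- tree decomposition, plus the (local form of the) connectivity axiom:
  -- for a child c of t, X_t ∩ V_c ⊆ X_c, and at a join, V_l ∩ V_r ⊆ X_t.
  data WF : NTree → Set where
    leaf   : WF leaf
    introV : ∀ {v t} → v ∉ bag t →
             (bag (introV v t) ∩ Vt t) ⊆ bag t → WF t → WF (introV v t)
    introE : ∀ {e t} → proj₁ (ends G e) ∈ bag t → proj₂ (ends G e) ∈ bag t →
             WF t → WF (introE e t)
    forget : ∀ {v t} → v ∈ bag t →
             (bag (forget v t) ∩ Vt t) ⊆ bag t → WF t → WF (forget v t)
    join   : ∀ {l r} → bag l ≡ bag r →
             (bag (join l r) ∩ Vt l) ⊆ bag l →
             (bag (join l r) ∩ Vt r) ⊆ bag r →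
             (Vt l ∩ Vt r) ⊆ bag (join l r) → WF l → WF r → WF (join l r)

  IsNiceTD : NTree → Set
  IsNiceTD T = WF T × (bag T ≡ ⊥) × (Vt T ≡ ⊤) × (∀ e → introCount e T ≡ 1)

  -- The nearly-nice decomposition: add the fixed terminal v⋆ to each bag.

  module _ (K : Subset (n G)) (v⋆ : Fin (n G)) where

    bag⋆ : NTree → Subset (n G)
    bag⋆ t = bag t ∪ ⁅ v⋆ ⁆

    Vt⋆ : NTree → Subset (n G)
    Vt⋆ t = Vt t ∪ ⁅ v⋆ ⁆

    -- A partition of X ⊆ X_t into p (non-empty) blocks, given by the block
    -- index blk x of each x ∈ X.
    IsPartitionOf : Subset (n G) → (p : ℕ) → (Fin (n G) → Fin p) → Set
    IsPartitionOf X p blk = ∀ i → ∃ λ x → (x ∈ X) × (blk x ≡ i)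

    -- The partition (p , blk) of X is valid for (t , X , O): there is a
    -- subgraph (U , F) of G_t = (V_t , E_t) with X_t ∩ U = X, exactly p
    -- connected components C_1..C_p (labelled by comp) with X^i ⊆ V(C_i),
    -- containing every terminal of K ∩ V_t, and with odd-degree set O.
    Valid : (t : NTree) (X O : Subset (n G)) (p : ℕ) (blk : Fin (n G) → Fin p) → Set
    Valid t X O p blk =
      IsPartitionOf X p blk ×
      (Σ (Subset (n G)) λ U → Σ (Subset (m G)) λ F →
        IsSubgraphOf U F (Vt⋆ t) (Et t) ×
        (bag⋆ t ∩ U ≡ X) ×
        (Σ (Fin (n G) → Fin p) λ comp →
          (∀ {u w} → u ∈ U → w ∈ U → Reach U F u w ⇔ (comp u ≡ comp w)) ×
          (∀ i → ∃ λ u → (u ∈ U) × (comp u ≡ i)) ×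
          (∀ {x} → x ∈ X → comp x ≡ blk x)) ×
        ((K ∩ Vt⋆ t) ⊆ U) ×
        OddSetIs U F O)

module Submission where

-- At the root r of the nearly-nice decomposition the graph
-- G_r is all of G (every vertex lies in some bag, every edge is introduced
-- somewhere) and the bag is X_r = {v⋆}.  A subgraph witnessing validity of
-- {{v⋆}} for (r, {v⋆}, ∅) is therefore a subgraph of G that contains every
-- terminal, meets X_r exactly in v⋆, has exactly one connected component,
-- and has no odd-degree vertex — i.e. an Eulerian Steiner subgraph for K,
-- and conversely (v⋆ ∈ K guarantees the meeting condition).

open import Defs
open import Data.Fin using (Fin; zero)
open import Data.Fin.Subset using (Subset; ⊥; ⁅_⁆; _∈_)
open import Data.Product using (_×_)
open import Relation.Nullary using (¬_)
open import Relation.Binary.PropositionalEquality using (_≡_)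
open import Function.Bundles using (_⇔_)

open import Data.Nat using (suc)
open import Data.Nat.Properties using (1+n≢0)
open import Data.Fin.Properties using (_≟_)
open import Data.Fin.Subset using (_⊆_; _∪_; _∩_)
open import Data.Fin.Subset.Properties
  using (∉⊥; ∈⊤; x∈⁅x⁆; x∈⁅y⁆⇒x≡y; ⊆-antisym; p∩q⊆p; x∈p∩q⁺; x∈p∩q⁻;
         x∈p∪q⁺; ∪-identityˡ)
open import Data.Product using (_,_; proj₁)
open import Data.Sum using (inj₁; inj₂)
open import Data.Empty using (⊥-elim)
open import Relation.Nullary using (yes; no)
open import Relation.Binary.PropositionalEquality
  using (refl; sym; trans; subst; _≢_; cong₂; module ≡-Reasoning)
open import Function.Bundles using (mk⇔; module Equivalence)

open Equivalence using (to; from)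

⁅x⁆∩p≡⁅x⁆ : ∀ {k} {p : Subset k} {x : Fin k} → x ∈ p → ⁅ x ⁆ ∩ p ≡ ⁅ x ⁆
⁅x⁆∩p≡⁅x⁆ {p = p} {x} x∈p = ⊆-antisym (p∩q⊆p ⁅ x ⁆ p) ⁅x⁆⊆⁅x⁆∩p
  where
  ⁅x⁆⊆⁅x⁆∩p : ⁅ x ⁆ ⊆ ⁅ x ⁆ ∩ p
  ⁅x⁆⊆⁅x⁆∩p y∈⁅x⁆ with x∈⁅y⁆⇒x≡y x y∈⁅x⁆
  ... | refl = x∈p∩q⁺ (y∈⁅x⁆ , x∈p)

Fin1-unique : (a b : Fin 1) → a ≡ b
Fin1-unique zero zero = refl

module _ (G : Graph) where

  edgesIntroduced⊆Et : (t : NTree G) {e : Fin (m G)} →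
                       introCount G e t ≢ 0 → e ∈ Et G t
  edgesIntroduced⊆Et leaf         c≢0 = ⊥-elim (c≢0 refl)
  edgesIntroduced⊆Et (introV v t) c≢0 = edgesIntroduced⊆Et t c≢0
  edgesIntroduced⊆Et (introE f t) {e} c≢0 with f ≟ e
  ... | yes refl = x∈p∪q⁺ (inj₁ (x∈⁅x⁆ f))
  ... | no  _    = x∈p∪q⁺ (inj₂ (edgesIntroduced⊆Et t c≢0))
  edgesIntroduced⊆Et (forget v t) c≢0 = edgesIntroduced⊆Et t c≢0
  edgesIntroduced⊆Et (join l r)   {e} c≢0 with introCount G e l in cₗ
  ... | 0     = x∈p∪q⁺ (inj₂ (edgesIntroduced⊆Et r c≢0))
  ... | suc _ = x∈p∪q⁺ (inj₁ (edgesIntroduced⊆Et l (λ cₗ≡0 → 1+n≢0 (trans (sym cₗ) cₗ≡0))))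

  niceTD-covers-edges : (T : NTree G) → IsNiceTD G T → ∀ {e} → e ∈ Et G T
  niceTD-covers-edges T (_ , _ , _ , once) {e} =
    edgesIntroduced⊆Et T (λ c≡0 → 1+n≢0 (trans (sym (once e)) c≡0))

  niceTD-covers-vertices : (T : NTree G) → IsNiceTD G T →
                           (K : Subset (n G)) (v⋆ : Fin (n G)) →
                           ∀ {x} → x ∈ Vt⋆ G K v⋆ T
  niceTD-covers-vertices T (_ , _ , Vt≡⊤ , _) K v⋆ =
    x∈p∪q⁺ (inj₁ (subst (_ ∈_) (sym Vt≡⊤) ∈⊤))

  rootBag∩U : (T : NTree G) → bag G T ≡ ⊥ →
              (K : Subset (n G)) {v⋆ : Fin (n G)} {U : Subset (n G)} →
              v⋆ ∈ U → bag⋆ G K v⋆ T ∩ U ≡ ⁅ v⋆ ⁆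
  rootBag∩U T bag≡⊥ K {v⋆} {U} v⋆∈U = begin
    (bag G T ∪ ⁅ v⋆ ⁆) ∩ U ≡⟨ cong₂ _∩_ (cong₂ _∪_ bag≡⊥ refl) refl ⟩
    (⊥ ∪ ⁅ v⋆ ⁆) ∩ U       ≡⟨ cong₂ _∩_ (∪-identityˡ ⁅ v⋆ ⁆) refl ⟩
    ⁅ v⋆ ⁆ ∩ U             ≡⟨ ⁅x⁆∩p≡⁅x⁆ v⋆∈U ⟩
    ⁅ v⋆ ⁆                 ∎
    where open ≡-Reasoning

  module _ (U : Subset (n G)) (F : Subset (m G)) where

    connected⇒oneComponent : Connected G U F →
      ∀ {u w} → u ∈ U → w ∈ U → Reach G U F u w ⇔ (zero {0} ≡ zero)
    connected⇒oneComponent conn u∈U w∈U = mk⇔ (λ _ → refl) (λ _ → conn u∈U w∈U)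

    oneComponent⇒connected : (comp : Fin (n G) → Fin 1) →
      (∀ {u w} → u ∈ U → w ∈ U → Reach G U F u w ⇔ (comp u ≡ comp w)) →
      Connected G U F
    oneComponent⇒connected comp reach {u} {w} u∈U w∈U =
      from (reach u∈U w∈U) (Fin1-unique (comp u) (comp w))

    noOddVertices⇔allEven :
      OddSetIs G U F ⊥ ⇔ (∀ v → v ∈ U → ¬ Odd G (degree G F v))
    noOddVertices⇔allEven = mk⇔
      (λ oddSet v v∈U odd → ∉⊥ (from (oddSet v) (v∈U , odd)))
      (λ even v → mk⇔ (λ v∈⊥ → ⊥-elim (∉⊥ v∈⊥))
                      (λ { (v∈U , odd) → ⊥-elim (even v v∈U odd) }))

lemma17 : (G : Graph) (K : Subset (n G)) (v⋆ : Fin (n G)) (T : NTree G) →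
    IsNiceTD G T → v⋆ ∈ K →
    HasEulerianSteinerSubgraph G K ⇔
    Valid G K v⋆ T ⁅ v⋆ ⁆ ⊥ 1 (λ _ → zero)
lemma17 G K v⋆ T nice@(_ , bag≡⊥ , _ , _) v⋆∈K = mk⇔ toValid toEulerian
  where
  allVertices : ∀ {x} → x ∈ Vt⋆ G K v⋆ T
  allVertices = niceTD-covers-vertices G T nice K v⋆

  singleBlock : IsPartitionOf G K v⋆ ⁅ v⋆ ⁆ 1 (λ _ → zero)
  singleBlock zero = v⋆ , x∈⁅x⁆ v⋆ , refl

  toValid : HasEulerianSteinerSubgraph G K → Valid G K v⋆ T ⁅ v⋆ ⁆ ⊥ 1 (λ _ → zero)
  toValid (U , F , (_ , _ , ends∈U) , (conn , even) , K⊆U) =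
    singleBlock , U , F ,
    ((λ _ → allVertices) , (λ _ → niceTD-covers-edges G T nice) , ends∈U) ,
    rootBag∩U G T bag≡⊥ K (K⊆U v⋆∈K) ,
    ((λ _ → zero) , connected⇒oneComponent G U F conn ,
     (λ { zero → v⋆ , K⊆U v⋆∈K , refl }) , (λ _ → refl)) ,
    (λ x∈K∩Vt → K⊆U (proj₁ (x∈p∩q⁻ K _ x∈K∩Vt))) ,
    from (noOddVertices⇔allEven G U F) even

  toEulerian : Valid G K v⋆ T ⁅ v⋆ ⁆ ⊥ 1 (λ _ → zero) → HasEulerianSteinerSubgraph G K
  toEulerian (_ , U , F , (_ , _ , ends∈U) , _ , (comp , reach , _) , K∩Vt⊆U , oddSet) =
    U , F , ((λ _ → ∈⊤) , (λ _ → ∈⊤) , ends∈U) ,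
    (oneComponent⇒connected G U F comp reach , to (noOddVertices⇔allEven G U F) oddSet) ,
    (λ x∈K → K∩Vt⊆U (x∈p∩q⁺ (x∈K , allVertices)))
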